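{- Let $G$ be a graph of order $n$, where $n\geq 4$ is even. Then $\pi_3(G)=\frac{n}{2}$ if and only if $G$ is the complete graph $K_n$.
   Context: All graphs are finite, simple and undirected. For a graph $G$ and $S\subseteq V(G)$ with $|S|\geq 2$, an $S$-path is a subgraph of $G$ that is a path containing all vertices of $S$; two $S$-paths $P,P'$ are internally disjoint if $E(P)\cap E(P')=\varnothing$ and $V(P)\cap V(P')=S$. $\pi_G(S)$ is the maximum number of pairwise internally disjoint $S$-paths, and for $2\leq k\leq |V(G)|$, $\pi_k(G)=\min\{\pi_G(S): S\subseteq V(G), |S|=k\}$. -}

module Defs where

open import Data.Nat using (ℕ; zero; suc; _≤_)
open import Data.Bool using (Bool; true; false)
open import Data.Fin using (Fin)
open import Data.Fin.Subset using (Subset; _∈_; ∣_∣)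
open import Data.List using (List; []; _∷_; length)
open import Data.List.Relation.Unary.All using (All)
open import Data.List.Relation.Unary.AllPairs using (AllPairs)
open import Data.List.Relation.Unary.Unique.Propositional using (Unique)
import Data.List.Membership.Propositional as LM
open import Data.Product using (Σ; _×_; ∃)
open import Data.Sum using (_⊎_)
open import Data.Empty using (⊥)
open import Data.Unit using (⊤)
open import Relation.Nullary using (¬_)
open import Relation.Binary.PropositionalEquality using (_≡_; _≢_)

record Graph (n : ℕ) : Set where
  field
    adj   : Fin n → Fin n → Bool
    sym   : ∀ u v → adj u v ≡ adj v u
    irrfl : ∀ u → adj u u ≡ false

open Graph public

IsComplete : ∀ {n} → Graph n → Set
IsComplete {n} G = ∀ (u v : Fin n) → u ≢ v → adj G u v ≡ true

Walk : ∀ {n} → Graph n → List (Fin n) → Set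
Walk G []             = ⊥
Walk G (v ∷ [])       = ⊤
Walk G (u ∷ v ∷ rest) = (adj G u v ≡ true) × Walk G (v ∷ rest)

IsPath : ∀ {n} → Graph n → List (Fin n) → Set
IsPath G p = Walk G p × Unique p

_∈V_ : ∀ {n} → Fin n → List (Fin n) → Set
x ∈V p = x LM.∈ p

Consec : ∀ {n} → Fin n → Fin n → List (Fin n) → Set
Consec u v []             = ⊥
Consec u v (x ∷ [])       = ⊥
Consec u v (x ∷ y ∷ rest) = (u ≡ x × v ≡ y) ⊎ Consec u v (y ∷ rest)

EdgeOf : ∀ {n} → Fin n → Fin n → List (Fin n) → Set
EdgeOf u v p = Consec u v p ⊎ Consec v u p

IsSPath : ∀ {n} → Graph n → Subset n → List (Fin n) → Set
IsSPath {n} G S p = IsPath G p × (∀ (x : Fin n) → x ∈ S → x ∈V p)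

-- Two S-paths are internally disjoint: E(P) ∩ E(P') = ∅ and
-- V(P) ∩ V(P') = S (⊇ holds as both contain S).
InternallyDisjoint : ∀ {n} → Subset n → List (Fin n) → List (Fin n) → Set
InternallyDisjoint {n} S p q =
  (∀ (u v : Fin n) → EdgeOf u v p → EdgeOf u v q → ⊥) ×
  (∀ (x : Fin n) → x ∈V p → x ∈V q → x ∈ S)

IsSPathFamily : ∀ {n} → Graph n → Subset n → List (List (Fin n)) → Set
IsSPathFamily G S F = All (IsSPath G S) F × AllPairs (InternallyDisjoint S) F

PiG≡ : ∀ {n} → Graph n → Subset n → ℕ → Set
PiG≡ G S m =
  (Σ (List (List _)) λ F → IsSPathFamily G S F × length F ≡ m) ×
  (∀ F → IsSPathFamily G S F → length F ≤ m)

Pik≡ : ∀ {n} → Graph n → ℕ → ℕ → Set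
Pik≡ {n} G k m =
  (Σ (Subset n) λ S → ∣ S ∣ ≡ k × PiG≡ G S m) ×
  (∀ (S : Subset n) (p : ℕ) → ∣ S ∣ ≡ k → PiG≡ G S p → m ≤ p)

module Submission where

-- Fix three terminals S = {a, b, c}.  Upper bound, in any graph: the tokens of an
-- S-path P are its non-terminal vertices together with each terminal t whose two
-- partners are joined by an edge of P.  Every S-path has two distinct tokens (it has two
-- inner vertices, or it runs through the terminals and at most one further vertex), and
-- internally disjoint S-paths share no token; hence every family F has 2|F| ≤ n, and
-- 2|F| + 1 ≤ n when ab is not an edge, since then c is never a token.  Lower bound, in
-- Kₙ: the paths a b c, b x c a and a y b z c, for disjoint pairs y, z of the other
-- n − 4 vertices, are k internally disjoint S-paths.  So every 3-set of Kₙ has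
-- π_G(S) = k; conversely a non-edge uv gives S = {u, v, w} with π_G(S) < k (the maximum
-- π_G(S) exists up to double negation, which suffices to refute π₃(G) = k).

open import Defs hiding (sym)
open import Data.Nat using (ℕ; zero; suc; _≤_; _+_; _/_; _≤?_; z≤n; s≤s)
open import Data.Nat.Properties
  using (≤-trans; ≤-antisym; ≰⇒>; +-mono-≤; +-monoʳ-≤; +-suc; +-identityʳ; *-comm; 1+n≰n; n≤1+n; m≤m+n; m≤n⇒m<n∨m≡n)
open import Data.Nat.Solver using (module +-*-Solver)
open +-*-Solver using (solve; _:+_; _:=_; con)
open import Data.Nat.Divisibility using (_∣_; divides)
open import Data.Nat.DivMod using (m*n/n≡m)
open import Data.Bool using (Bool; true; false)
open import Data.Fin as Fin using (Fin)
open import Data.Fin.Properties using (suc-injective; _≟_)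
open import Data.Fin.Subset using (Subset; _∈_; ∣_∣; ⁅_⁆; _∪_; inside; outside)
  renaming (⊥ to ∅)
open import Data.Fin.Subset.Properties using (x∈p∪q⁻; x∈p∪q⁺; x∈⁅x⁆; x∈⁅y⁆⇒x≡y; ∉⊥)
open import Data.Vec using ([]; _∷_; here; there)
open import Data.List using (List; []; _∷_; length; map; allFin; filter; _++_)
open import Data.List.Properties using (length-map; length-tabulate)
open import Data.List.Relation.Unary.All as All using (All; []; _∷_)
open import Data.List.Relation.Unary.Any using (Any; here; there)
open import Data.List.Relation.Unary.AllPairs using (AllPairs; []; _∷_)
open import Data.List.Relation.Unary.Unique.Propositional using (Unique)
import Data.List.Relation.Unary.Unique.Propositional.Properties as Unique
open import Data.List.Membership.Propositional using () renaming (_∈_ to _∈ₗ_; _∉_ to _∉ₗ_)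
open import Data.List.Membership.Propositional.Properties
  using (∈-map⁺; ∈-map⁻; ∈-allFin; ∈-filter⁺; ∈-filter⁻; ∈-++⁺ˡ; ∈-++⁺ʳ)
open import Data.Product using (Σ; _×_; _,_; proj₁; proj₂; map₁)
open import Data.Sum using (_⊎_; inj₁; inj₂; swap)
open import Data.Empty using (⊥; ⊥-elim)
open import Data.Unit using (tt)
open import Relation.Nullary using (¬_; Dec; yes; no)
open import Relation.Binary.PropositionalEquality
  using (_≡_; _≢_; refl; sym; trans; cong; subst; subst₂; ≢-sym)
open import Function.Bundles using (_⇔_; mk⇔)

halve : ∀ x k → x + x ≤ suc (k + k) → x ≤ k
halve x k x+x≤ with x ≤? k
... | yes x≤k = x≤k
... | no  x≰k = ⊥-elim (1+n≰n (≤-trans 2k+2≤x+x x+x≤))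
  where
  2k+2≤x+x : suc (suc (k + k)) ≤ x + x
  2k+2≤x+x = subst (_≤ x + x) (cong suc (+-suc k k)) (+-mono-≤ (≰⇒> x≰k) (≰⇒> x≰k))

delete : ∀ {A : Set} {x : A} (ys : List A) → x ∈ₗ ys →
         Σ (List A) λ ys′ → length ys ≡ suc (length ys′) × (∀ {z} → z ∈ₗ ys → z ≢ x → z ∈ₗ ys′)
delete (y ∷ ys) (here refl) = ys , refl , λ { (here refl) z≢x → ⊥-elim (z≢x refl) ; (there z∈) _ → z∈ }
delete (y ∷ ys) (there x∈ys) with delete ys x∈ys
... | ys′ , len , keep = y ∷ ys′ , cong suc len , λ { (here refl) _ → here refl ; (there z∈) z≢x → there (keep z∈ z≢x) }

unique-⊆⇒≤ : ∀ {A : Set} (xs ys : List A) → Unique xs → (∀ {z} → z ∈ₗ xs → z ∈ₗ ys) → length xs ≤ length ys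
unique-⊆⇒≤ []       ys _              _   = z≤n
unique-⊆⇒≤ (x ∷ xs) ys (x∉xs ∷ uxs) xs⊆ys with delete ys (xs⊆ys (here refl))
... | ys′ , len , keep = subst (suc (length xs) ≤_) (sym len)
  (s≤s (unique-⊆⇒≤ xs ys′ uxs λ z∈xs → keep (xs⊆ys (there z∈xs)) λ { refl → All.lookup x∉xs z∈xs refl }))

same-members⇒≡ : ∀ {A : Set} (xs ys : List A) → Unique xs → Unique ys →
                 (∀ {z} → z ∈ₗ xs → z ∈ₗ ys) → (∀ {z} → z ∈ₗ ys → z ∈ₗ xs) → length xs ≡ length ys
same-members⇒≡ xs ys uxs uys xs⊆ys ys⊆xs = ≤-antisym (unique-⊆⇒≤ xs ys uxs xs⊆ys) (unique-⊆⇒≤ ys xs uys ys⊆xs)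

unique-fin-≤ : ∀ {n} (xs : List (Fin n)) → Unique xs → length xs ≤ n
unique-fin-≤ {n} xs uxs = subst (length xs ≤_) (length-tabulate (λ x → x))
  (unique-⊆⇒≤ xs (allFin n) uxs λ {z} _ → ∈-allFin z)

record Enumerates {n} (L : List (Fin n)) (S : Subset n) : Set where
  field
    unique   : Unique L
    sound    : ∀ {x} → x ∈ₗ L → x ∈ S
    complete : ∀ {x} → x ∈ S → x ∈ₗ L

elements : ∀ {n} → Subset n → List (Fin n)
elements []            = []
elements (inside  ∷ p) = Fin.zero ∷ map Fin.suc (elements p)
elements (outside ∷ p) = map Fin.suc (elements p)

length-elements : ∀ {n} (p : Subset n) → length (elements p) ≡ ∣ p ∣
length-elements []            = refl
length-elements (inside  ∷ p) = cong suc (trans (length-map Fin.suc (elements p)) (length-elements p))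
length-elements (outside ∷ p) = trans (length-map Fin.suc (elements p)) (length-elements p)

elements-enumerates : ∀ {n} (p : Subset n) → Enumerates (elements p) p
elements-enumerates [] = record { unique = [] ; sound = λ () ; complete = λ () }
elements-enumerates (side ∷ p) = record { unique = unique side ; sound = sound side ; complete = complete side }
  where
  open Enumerates (elements-enumerates p) renaming (unique to uniqueₚ; sound to soundₚ; complete to completeₚ)
  shifted-unique : Unique (map Fin.suc (elements p))
  shifted-unique = Unique.map⁺ suc-injective uniqueₚ
  shifted-sound : ∀ {side′ x} → x ∈ₗ map Fin.suc (elements p) → x ∈ (side′ ∷ p)
  shifted-sound x∈ with ∈-map⁻ Fin.suc x∈
  ... | y , y∈ , refl = there (soundₚ y∈)
  zero∉shifted : Fin.zero ∉ₗ map Fin.suc (elements p)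
  zero∉shifted x∈ with ∈-map⁻ Fin.suc x∈
  ... | _ , _ , ()
  unique : ∀ side′ → Unique (elements (side′ ∷ p))
  unique inside  = All.tabulate (λ { x∈ refl → zero∉shifted x∈ }) ∷ shifted-unique
  unique outside = shifted-unique
  sound : ∀ side′ {x} → x ∈ₗ elements (side′ ∷ p) → x ∈ (side′ ∷ p)
  sound inside  (here refl) = here
  sound inside  (there x∈)  = shifted-sound x∈
  sound outside x∈          = shifted-sound x∈
  complete : ∀ side′ {x} → x ∈ (side′ ∷ p) → x ∈ₗ elements (side′ ∷ p)
  complete inside  here        = here refl
  complete inside  (there x∈p) = there (∈-map⁺ Fin.suc (completeₚ x∈p))
  complete outside (there x∈p) = ∈-map⁺ Fin.suc (completeₚ x∈p)

enumerates⇒size : ∀ {n} {L : List (Fin n)} {S : Subset n} → Enumerates L S → ∣ S ∣ ≡ length L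
enumerates⇒size {L = L} {S} enum = trans (sym (length-elements S))
  (same-members⇒≡ (elements S) L E.unique unique (λ x∈ → complete (E.sound x∈)) (λ x∈ → E.complete (sound x∈)))
  where
  open Enumerates enum
  module E = Enumerates (elements-enumerates S)

fromList : ∀ {n} → List (Fin n) → Subset n
fromList []       = ∅
fromList (x ∷ xs) = ⁅ x ⁆ ∪ fromList xs

fromList-enumerates : ∀ {n} (L : List (Fin n)) → Unique L → Enumerates L (fromList L)
fromList-enumerates L uL = record { unique = uL ; sound = sound L ; complete = complete L }
  where
  sound : ∀ L {x} → x ∈ₗ L → x ∈ fromList L
  sound (y ∷ ys) (here refl) = x∈p∪q⁺ (inj₁ (x∈⁅x⁆ y))
  sound (y ∷ ys) (there x∈)  = x∈p∪q⁺ (inj₂ (sound ys x∈))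
  complete : ∀ L {x} → x ∈ fromList L → x ∈ₗ L
  complete []       x∈ = ⊥-elim (∉⊥ x∈)
  complete (y ∷ ys) x∈ with x∈p∪q⁻ ⁅ y ⁆ (fromList ys) x∈
  ... | inj₁ x∈⁅y⁆ = here (x∈⁅y⁆⇒x≡y y x∈⁅y⁆)
  ... | inj₂ x∈ys  = there (complete ys x∈ys)

size-3⇒triple : ∀ {n} (S : Subset n) → ∣ S ∣ ≡ 3 →
                Σ (Fin n) λ a → Σ (Fin n) λ b → Σ (Fin n) λ c → Enumerates (a ∷ b ∷ c ∷ []) S
size-3⇒triple S |S|≡3 = listed (elements S) (elements-enumerates S) (trans (length-elements S) |S|≡3)
  where
  listed : ∀ L → Enumerates L S → length L ≡ 3 →
           Σ (Fin _) λ a → Σ (Fin _) λ b → Σ (Fin _) λ c → Enumerates (a ∷ b ∷ c ∷ []) S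
  listed (a ∷ b ∷ c ∷ []) enum refl = a , b , c , enum

consec⇒members : ∀ {n} {u v : Fin n} P → Consec u v P → u ∈ₗ P × v ∈ₗ P
consec⇒members (x ∷ y ∷ P) (inj₁ (refl , refl)) = here refl , there (here refl)
consec⇒members (x ∷ y ∷ P) (inj₂ uv∈) with consec⇒members (y ∷ P) uv∈
... | u∈ , v∈ = there u∈ , there v∈

edge⇒members : ∀ {n} {u v : Fin n} P → EdgeOf u v P → u ∈ₗ P × v ∈ₗ P
edge⇒members P (inj₁ uv∈) = consec⇒members P uv∈
edge⇒members P (inj₂ vu∈) with consec⇒members P vu∈
... | v∈ , u∈ = u∈ , v∈

walk-consec⇒adj : ∀ {n} (G : Graph n) {u v} P → Walk G P → Consec u v P → adj G u v ≡ true
walk-consec⇒adj G (x ∷ y ∷ P) (xy , _) (inj₁ (refl , refl)) = xy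
walk-consec⇒adj G (x ∷ y ∷ P) (_ , w) (inj₂ uv∈)          = walk-consec⇒adj G (y ∷ P) w uv∈

walk-edge⇒adj : ∀ {n} (G : Graph n) {u v} P → Walk G P → EdgeOf u v P → adj G u v ≡ true
walk-edge⇒adj G P w (inj₁ uv∈)         = walk-consec⇒adj G P w uv∈
walk-edge⇒adj G {u} {v} P w (inj₂ vu∈) = trans (Graph.sym G u v) (walk-consec⇒adj G P w vu∈)

¬¬-maximum : (P : ℕ → Set) → P 0 → (B : ℕ) → (∀ k → P k → k ≤ B) →
             ¬ ¬ (Σ ℕ λ m → P m × (∀ k → P k → k ≤ m))
¬¬-maximum P p0 zero    bounded no-max = no-max (0 , p0 , bounded)
¬¬-maximum P p0 (suc B) bounded no-max =
  -- whether or not P (B + 1) holds is not-not decided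
  no-max′ (inj₂ λ PB+1 → no-max′ (inj₁ PB+1))
  where
  no-max′ : P (suc B) ⊎ ¬ P (suc B) → ⊥
  no-max′ (inj₁ PB+1)  = no-max (suc B , PB+1 , bounded)
  no-max′ (inj₂ ¬PB+1) = ¬¬-maximum P p0 B below no-max
    where
    below : ∀ k → P k → k ≤ B
    below k Pk with m≤n⇒m<n∨m≡n (bounded k Pk)
    ... | inj₁ (s≤s k≤B) = k≤B
    ... | inj₂ refl      = ⊥-elim (¬PB+1 Pk)

module Terminals {n : ℕ} (a b c : Fin n) (a≢b : a ≢ b) (b≢c : b ≢ c) (a≢c : a ≢ c) where

  open import Data.List.Membership.DecPropositional (_≟_ {n}) using (_∈?_; _∉?_)

  T : List (Fin n)
  T = a ∷ b ∷ c ∷ []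

  T-unique : Unique T
  T-unique = (a≢b ∷ a≢c ∷ []) ∷ (b≢c ∷ []) ∷ [] ∷ []

  a∈T : a ∈ₗ T
  a∈T = here refl

  b∈T : b ∈ₗ T
  b∈T = there (here refl)

  c∈T : c ∈ₗ T
  c∈T = there (there (here refl))

  terminal? : ∀ x → Dec (x ∈ₗ T)
  terminal? x = x ∈? T

  no-four-terminals : ∀ {w x y z} → Unique (w ∷ x ∷ y ∷ z ∷ []) →
                      w ∈ₗ T → x ∈ₗ T → y ∈ₗ T → z ∈ₗ T → ⊥
  no-four-terminals {w} {x} {y} {z} distinct w∈ x∈ y∈ z∈ =
    1+n≰n (unique-⊆⇒≤ (w ∷ x ∷ y ∷ z ∷ []) T distinct
      λ { (here refl) → w∈ ; (there (here refl)) → x∈ ; (there (there (here refl))) → y∈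
        ; (there (there (there (here refl)))) → z∈ })

  other-terminals : ∀ {u v t x} → u ∈ₗ T → v ∈ₗ T → t ∈ₗ T → u ≢ v → u ≢ t → v ≢ t →
                    x ∈ₗ T → x ≢ t → x ≡ u ⊎ x ≡ v
  other-terminals {u} {v} {t} {x} u∈ v∈ t∈ u≢v u≢t v≢t x∈ x≢t with x ≟ u | x ≟ v
  ... | yes x≡u | _       = inj₁ x≡u
  ... | no  _   | yes x≡v = inj₂ x≡v
  ... | no  x≢u | no  x≢v = ⊥-elim (no-four-terminals
          ((x≢u ∷ x≢v ∷ x≢t ∷ []) ∷ (u≢v ∷ u≢t ∷ []) ∷ (v≢t ∷ []) ∷ [] ∷ []) x∈ u∈ v∈ t∈)

  outsiders : List (Fin n) → List (Fin n)
  outsiders = filter (_∉? T)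

  ∈-outsiders⁻ : ∀ {x} xs → x ∈ₗ outsiders xs → x ∈ₗ xs × x ∉ₗ T
  ∈-outsiders⁻ xs = ∈-filter⁻ _ {xs = xs}

  ∈-outsiders⁺ : ∀ {x xs} → x ∈ₗ xs → x ∉ₗ T → x ∈ₗ outsiders xs
  ∈-outsiders⁺ = ∈-filter⁺ _

  outsiders-unique : ∀ {xs} → Unique xs → Unique (outsiders xs)
  outsiders-unique = Unique.filter⁺ _

  length-≤-3+outsiders : ∀ xs → Unique xs → length xs ≤ 3 + length (outsiders xs)
  length-≤-3+outsiders xs uxs = unique-⊆⇒≤ xs (T ++ outsiders xs) uxs split
    where
    split : ∀ {z} → z ∈ₗ xs → z ∈ₗ T ++ outsiders xs
    split {z} z∈ with terminal? z
    ... | yes z∈T = ∈-++⁺ˡ z∈T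
    ... | no  z∉T = ∈-++⁺ʳ T (∈-outsiders⁺ z∈ z∉T)

module UpperBound {n : ℕ} (G : Graph n) (a b c : Fin n) (a≢b : a ≢ b) (b≢c : b ≢ c) (a≢c : a ≢ c)
                  (S : Subset n) (S=T : Enumerates (a ∷ b ∷ c ∷ []) S) where
  open Terminals a b c a≢b b≢c a≢c
  open Enumerates S=T using (sound; complete)

  record OppositeEdge (P : List (Fin n)) (t : Fin n) : Set where
    constructor opposite
    field
      {u v} : Fin n
      u∈T   : u ∈ₗ T
      v∈T   : v ∈ₗ T
      u≢v   : u ≢ v
      u≢t   : u ≢ t
      v≢t   : v ≢ t
      edge  : EdgeOf u v P

  Token : List (Fin n) → Fin n → Set
  Token P t = (t ∈ₗ P × t ∉ₗ T) ⊎ (t ∈ₗ T × OppositeEdge P t)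

  token-unshared : ∀ {P Q t} → InternallyDisjoint S P Q → Token P t → Token Q t → ⊥
  token-unshared (_ , shared-vertex) (inj₁ (t∈P , t∉T)) (inj₁ (t∈Q , _)) = t∉T (complete (shared-vertex _ t∈P t∈Q))
  token-unshared _ (inj₁ (_ , t∉T)) (inj₂ (t∈T , _)) = t∉T t∈T
  token-unshared _ (inj₂ (t∈T , _)) (inj₁ (_ , t∉T)) = t∉T t∈T
  token-unshared (no-shared-edge , _) (inj₂ (t∈T , opposite u∈ v∈ u≢v u≢t v≢t uv∈P))
                                      (inj₂ (_   , opposite u′∈ v′∈ u′≢v′ u′≢t v′≢t uv∈Q))
    with other-terminals u∈ v∈ t∈T u≢v u≢t v≢t u′∈ u′≢t | other-terminals u∈ v∈ t∈T u≢v u≢t v≢t v′∈ v′≢t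
  ... | inj₁ refl | inj₁ refl = u′≢v′ refl
  ... | inj₁ refl | inj₂ refl = no-shared-edge _ _ uv∈P uv∈Q
  ... | inj₂ refl | inj₁ refl = no-shared-edge _ _ uv∈P (swap uv∈Q)
  ... | inj₂ refl | inj₂ refl = u′≢v′ refl

  record TwoTokens (P : List (Fin n)) : Set where
    constructor two-tokens
    field
      first second : Fin n
      distinct     : first ≢ second
      first-token  : Token P first
      second-token : Token P second

  opposite-token : ∀ {P t u v} → t ∈ₗ T → u ∈ₗ T → v ∈ₗ T → u ≢ v → u ≢ t → v ≢ t → Consec u v P → Token P t
  opposite-token t∈ u∈ v∈ u≢v u≢t v≢t uv∈P = inj₂ (t∈ , opposite u∈ v∈ u≢v u≢t v≢t (inj₁ uv∈P))

  terminal-path-tokens : ∀ P → length P ≡ 3 → Unique P → All (_∈ₗ T) P → TwoTokens P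
  terminal-path-tokens (t₁ ∷ t₂ ∷ t₃ ∷ []) _ ((t₁≢t₂ ∷ t₁≢t₃ ∷ []) ∷ (t₂≢t₃ ∷ []) ∷ [] ∷ [])
                       (t₁∈ ∷ t₂∈ ∷ t₃∈ ∷ []) =
    two-tokens t₃ t₁ (≢-sym t₁≢t₃)
      (opposite-token t₃∈ t₁∈ t₂∈ t₁≢t₂ t₁≢t₃ t₂≢t₃ (inj₁ (refl , refl)))
      (opposite-token t₁∈ t₂∈ t₃∈ t₂≢t₃ (≢-sym t₁≢t₂) (≢-sym t₁≢t₃) (inj₂ (inj₁ (refl , refl))))

  one-outsider-path-tokens : ∀ P → length P ≡ 4 → Unique P → ∀ {x} → x ∈ₗ P → x ∉ₗ T →
                             All (λ y → y ≢ x → y ∈ₗ T) P → TwoTokens P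
  one-outsider-path-tokens (p₀ ∷ p₁ ∷ p₂ ∷ p₃ ∷ []) _
    ((p₀≢p₁ ∷ p₀≢p₂ ∷ p₀≢p₃ ∷ []) ∷ (p₁≢p₂ ∷ p₁≢p₃ ∷ []) ∷ (p₂≢p₃ ∷ []) ∷ [] ∷ []) x∈P x∉T
    (τ₀ ∷ τ₁ ∷ τ₂ ∷ τ₃ ∷ []) with x∈P
  ... | here refl =
    two-tokens p₀ p₁ p₀≢p₁ (inj₁ (x∈P , x∉T))
      (opposite-token (τ₁ (≢-sym p₀≢p₁)) (τ₂ (≢-sym p₀≢p₂)) (τ₃ (≢-sym p₀≢p₃))
        p₂≢p₃ (≢-sym p₁≢p₂) (≢-sym p₁≢p₃) (inj₂ (inj₂ (inj₁ (refl , refl)))))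
  ... | there (here refl) =
    two-tokens p₁ p₀ (≢-sym p₀≢p₁) (inj₁ (x∈P , x∉T))
      (opposite-token (τ₀ p₀≢p₁) (τ₂ (≢-sym p₁≢p₂)) (τ₃ (≢-sym p₁≢p₃))
        p₂≢p₃ (≢-sym p₀≢p₂) (≢-sym p₀≢p₃) (inj₂ (inj₂ (inj₁ (refl , refl)))))
  ... | there (there (here refl)) =
    two-tokens p₂ p₃ p₂≢p₃ (inj₁ (x∈P , x∉T))
      (opposite-token (τ₃ (≢-sym p₂≢p₃)) (τ₀ p₀≢p₂) (τ₁ p₁≢p₂)
        p₀≢p₁ p₀≢p₃ p₁≢p₃ (inj₁ (refl , refl)))
  ... | there (there (there (here refl))) =
    two-tokens p₃ p₂ (≢-sym p₂≢p₃) (inj₁ (x∈P , x∉T))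
      (opposite-token (τ₂ p₂≢p₃) (τ₀ p₀≢p₃) (τ₁ p₁≢p₃)
        p₀≢p₁ p₀≢p₂ p₁≢p₂ (inj₁ (refl , refl)))

  -- Every {a,b,c}-path has two distinct tokens: either it has two non-terminal
  -- vertices, or it is one of the two short shapes above.
  spath-two-tokens : ∀ P → IsSPath G S P → TwoTokens P
  spath-two-tokens P ((_ , P-unique) , covers) =
    by-outsiders (outsiders P) (∈-outsiders⁻ P) ∈-outsiders⁺ (outsiders-unique P-unique)
    where
    T⊆P : ∀ {t} → t ∈ₗ T → t ∈ₗ P
    T⊆P t∈T = covers _ (sound t∈T)

    by-outsiders : ∀ O → (∀ {x} → x ∈ₗ O → x ∈ₗ P × x ∉ₗ T) → (∀ {x} → x ∈ₗ P → x ∉ₗ T → x ∈ₗ O) →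
                   Unique O → TwoTokens P
    by-outsiders [] _ only-outsiders _ =
      terminal-path-tokens P (same-members⇒≡ P T P-unique T-unique terminal T⊆P) P-unique (All.tabulate terminal)
      where
      terminal : ∀ {y} → y ∈ₗ P → y ∈ₗ T
      terminal {y} y∈P with terminal? y
      ... | yes y∈T = y∈T
      ... | no  y∉T with only-outsiders y∈P y∉T
      ... | ()
    by-outsiders (x ∷ []) outsider only-outsiders _ =
      one-outsider-path-tokens P (same-members⇒≡ P (x ∷ T) P-unique xT-unique P⊆xT xT⊆P) P-unique
        x∈P x∉T (All.tabulate terminal)
      where
      x∈P : x ∈ₗ P
      x∈P = proj₁ (outsider (here refl))
      x∉T : x ∉ₗ T
      x∉T = proj₂ (outsider (here refl))
      terminal : ∀ {y} → y ∈ₗ P → y ≢ x → y ∈ₗ T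
      terminal {y} y∈P y≢x with terminal? y
      ... | yes y∈T = y∈T
      ... | no  y∉T with only-outsiders y∈P y∉T
      ... | here y≡x = ⊥-elim (y≢x y≡x)
      xT-unique : Unique (x ∷ T)
      xT-unique = All.tabulate (λ { t∈T refl → x∉T t∈T }) ∷ T-unique
      P⊆xT : ∀ {y} → y ∈ₗ P → y ∈ₗ x ∷ T
      P⊆xT {y} y∈P with y ≟ x
      ... | yes y≡x = here y≡x
      ... | no  y≢x = there (terminal y∈P y≢x)
      xT⊆P : ∀ {y} → y ∈ₗ x ∷ T → y ∈ₗ P
      xT⊆P (here refl) = x∈P
      xT⊆P (there y∈T) = T⊆P y∈T
    by-outsiders (x ∷ y ∷ _) outsider _ ((x≢y ∷ _) ∷ _) =
      two-tokens x y x≢y (inj₁ (outsider (here refl))) (inj₁ (outsider (there (here refl))))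

  tokens : ∀ F → All (IsSPath G S) F → List (Fin n)
  tokens []      []            = []
  tokens (P ∷ F) (P-spath ∷ F-spaths) = first ∷ second ∷ tokens F F-spaths
    where open TwoTokens (spath-two-tokens P P-spath)

  length-tokens : ∀ F F-spaths → length (tokens F F-spaths) ≡ length F + length F
  length-tokens []      []            = refl
  length-tokens (P ∷ F) (_ ∷ F-spaths) =
    cong suc (trans (cong suc (length-tokens F F-spaths)) (sym (+-suc (length F) (length F))))

  tokens-belong : ∀ F F-spaths {t} → t ∈ₗ tokens F F-spaths → Any (λ Q → Token Q t) F
  tokens-belong (P ∷ F) (P-spath ∷ _) (here refl) = here (TwoTokens.first-token (spath-two-tokens P P-spath))
  tokens-belong (P ∷ F) (P-spath ∷ _) (there (here refl)) = here (TwoTokens.second-token (spath-two-tokens P P-spath))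
  tokens-belong (P ∷ F) (_ ∷ F-spaths) (there (there t∈)) = there (tokens-belong F F-spaths t∈)

  token-fresh : ∀ {P t} F F-spaths → All (InternallyDisjoint S P) F → Token P t → t ∉ₗ tokens F F-spaths
  token-fresh F F-spaths disjoint P-token t∈ =
    All.lookupWith (λ P-Q-disjoint Q-token → token-unshared P-Q-disjoint P-token Q-token)
                   disjoint (tokens-belong F F-spaths t∈)

  tokens-unique : ∀ F F-spaths → AllPairs (InternallyDisjoint S) F → Unique (tokens F F-spaths)
  tokens-unique []      []                  []                = []
  tokens-unique (P ∷ F) (P-spath ∷ F-spaths) (disjoint ∷ F-disjoint) =
    (distinct ∷ All.tabulate (fresh first-token)) ∷ All.tabulate (fresh second-token) ∷
    tokens-unique F F-spaths F-disjoint
    where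
    open TwoTokens (spath-two-tokens P P-spath)
    fresh : ∀ {t} → Token P t → ∀ {y} → y ∈ₗ tokens F F-spaths → t ≢ y
    fresh P-token y∈ refl = token-fresh F F-spaths disjoint P-token y∈

  -- The tokens of a family are distinct vertices, two per path: 2|F| ≤ n.
  family-bound : ∀ F → IsSPathFamily G S F → length F + length F ≤ n
  family-bound F (F-spaths , F-disjoint) = subst (_≤ n) (length-tokens F F-spaths)
    (unique-fin-≤ (tokens F F-spaths) (tokens-unique F F-spaths F-disjoint))

  not-true-and-false : ∀ {β : Bool} → β ≡ true → β ≡ false → ⊥
  not-true-and-false refl ()

  -- If a and b are not adjacent, c is never a token: its opposite edge would be ab.
  c-not-a-token : adj G a b ≡ false → ∀ {P} → Walk G P → Token P c → ⊥
  c-not-a-token _ _ (inj₁ (_ , c∉T)) = c∉T c∈T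
  c-not-a-token a≁b {P} walk (inj₂ (_ , opposite u∈ v∈ u≢v u≢c v≢c uv∈P))
    with other-terminals a∈T b∈T c∈T a≢b a≢c b≢c u∈ u≢c | other-terminals a∈T b∈T c∈T a≢b a≢c b≢c v∈ v≢c
  ... | inj₁ refl | inj₁ refl = u≢v refl
  ... | inj₁ refl | inj₂ refl = not-true-and-false (walk-edge⇒adj G P walk uv∈P) a≁b
  ... | inj₂ refl | inj₁ refl = not-true-and-false (walk-edge⇒adj G P walk (swap uv∈P)) a≁b
  ... | inj₂ refl | inj₂ refl = u≢v refl

  family-bound-nonadjacent : adj G a b ≡ false → ∀ F → IsSPathFamily G S F → suc (length F + length F) ≤ n
  family-bound-nonadjacent a≁b F (F-spaths , F-disjoint) = subst (_≤ n) (cong suc (length-tokens F F-spaths))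
    (unique-fin-≤ (c ∷ tokens F F-spaths) (All.tabulate c-fresh ∷ tokens-unique F F-spaths F-disjoint))
    where
    c-fresh : ∀ {y} → y ∈ₗ tokens F F-spaths → c ≢ y
    c-fresh y∈ refl = All.lookupWith (λ { ((walk , _) , _) c-token → c-not-a-token a≁b walk c-token })
                                     F-spaths (tokens-belong F F-spaths y∈)

module Construction {n : ℕ} (G : Graph n) (G-complete : IsComplete G)
                    (a b c : Fin n) (a≢b : a ≢ b) (b≢c : b ≢ c) (a≢c : a ≢ c)
                    (S : Subset n) (S=T : Enumerates (a ∷ b ∷ c ∷ []) S) where
  open Terminals a b c a≢b b≢c a≢c
  open Enumerates S=T using (sound; complete)

  outsider-≢ : ∀ {x t} → x ∉ₗ T → t ∈ₗ T → x ≢ t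
  outsider-≢ x∉T t∈T refl = x∉T t∈T

  covers-S : ∀ {Q} → (∀ {t} → t ∈ₗ T → t ∈ₗ Q) → ∀ x → x ∈ S → x ∈ₗ Q
  covers-S T⊆Q x x∈S = T⊆Q (complete x∈S)

  Within : List (Fin n) → List (Fin n) → Set
  Within R Q = ∀ x → x ∈ₗ Q → x ∈ₗ T ⊎ x ∈ₗ R

  within-∷ : ∀ {y R Q} → Within R Q → Within (y ∷ R) Q
  within-∷ Q-within x x∈Q = Data.Sum.map₂ there (Q-within x x∈Q)

  TerminalEdgeFree : List (Fin n) → Set
  TerminalEdgeFree Q = ∀ u v → EdgeOf u v Q → u ∈ₗ T → v ∈ₗ T → ⊥

  -- Two paths meeting only in terminals and sharing no edge between terminals are
  -- internally disjoint (a shared edge has both ends shared, hence terminal).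
  disjoint-if : ∀ {P Q} → (∀ {x} → x ∈ₗ P → x ∈ₗ Q → x ∈ₗ T) →
                (∀ {u v} → EdgeOf u v P → EdgeOf u v Q → u ∈ₗ T → v ∈ₗ T → ⊥) → InternallyDisjoint S P Q
  disjoint-if {P} {Q} shared-terminal no-terminal-edge =
    (λ u v uv∈P uv∈Q → no-terminal-edge uv∈P uv∈Q
        (shared-terminal (proj₁ (edge⇒members P uv∈P)) (proj₁ (edge⇒members Q uv∈Q)))
        (shared-terminal (proj₂ (edge⇒members P uv∈P)) (proj₂ (edge⇒members Q uv∈Q)))) ,
    (λ x x∈P x∈Q → sound (shared-terminal x∈P x∈Q))

  disjoint-from-within : ∀ {R P Q} → (∀ {x} → x ∈ₗ P → x ∉ₗ T → x ∉ₗ R) →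
                         Within R Q → TerminalEdgeFree Q → InternallyDisjoint S P Q
  disjoint-from-within {R} {P} {Q} P-avoids-R Q-within Q-free = disjoint-if shared (λ _ uv∈Q → Q-free _ _ uv∈Q)
    where
    shared : ∀ {x} → x ∈ₗ P → x ∈ₗ Q → x ∈ₗ T
    shared {x} x∈P x∈Q with terminal? x | Q-within x x∈Q
    ... | yes x∈T | _         = x∈T
    ... | no  _   | inj₁ x∈T  = x∈T
    ... | no  x∉T | inj₂ x∈R  = ⊥-elim (P-avoids-R x∈P x∉T x∈R)

  through : Fin n → Fin n → List (Fin n)
  through y z = a ∷ y ∷ b ∷ z ∷ c ∷ []

  through-spath : ∀ {y z} → y ∉ₗ T → z ∉ₗ T → y ≢ z → IsSPath G S (through y z)
  through-spath {y} {z} y∉T z∉T y≢z =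
    ((G-complete a y a≢y , G-complete y b y≢b , G-complete b z b≢z , G-complete z c z≢c , tt) ,
     (a≢y ∷ a≢b ∷ a≢z ∷ a≢c ∷ []) ∷ (y≢b ∷ y≢z ∷ y≢c ∷ []) ∷ (b≢z ∷ b≢c ∷ []) ∷ (z≢c ∷ []) ∷ [] ∷ []) ,
    covers-S λ { (here refl) → here refl ; (there (here refl)) → there (there (here refl))
               ; (there (there (here refl))) → there (there (there (there (here refl)))) }
    where
    a≢y : a ≢ y
    a≢y = ≢-sym (outsider-≢ y∉T a∈T)
    y≢b : y ≢ b
    y≢b = outsider-≢ y∉T b∈T
    y≢c : y ≢ c
    y≢c = outsider-≢ y∉T c∈T
    a≢z : a ≢ z
    a≢z = ≢-sym (outsider-≢ z∉T a∈T)
    b≢z : b ≢ z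
    b≢z = ≢-sym (outsider-≢ z∉T b∈T)
    z≢c : z ≢ c
    z≢c = outsider-≢ z∉T c∈T

  -- Every edge of a y b z c has y or z as an end.
  through-edge-free : ∀ {y z} → y ∉ₗ T → z ∉ₗ T → TerminalEdgeFree (through y z)
  through-edge-free {y} {z} y∉T z∉T _ _ (inj₁ uv∈) u∈T v∈T = consec-free uv∈ u∈T v∈T
    where
    consec-free : ∀ {u v} → Consec u v (through y z) → u ∈ₗ T → v ∈ₗ T → ⊥
    consec-free (inj₁ (refl , refl))                         _   v∈T = y∉T v∈T
    consec-free (inj₂ (inj₁ (refl , refl)))                  u∈T _   = y∉T u∈T
    consec-free (inj₂ (inj₂ (inj₁ (refl , refl))))           _   v∈T = z∉T v∈T
    consec-free (inj₂ (inj₂ (inj₂ (inj₁ (refl , refl)))))    u∈T _   = z∉T u∈T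
    consec-free (inj₂ (inj₂ (inj₂ (inj₂ ()))))               _   _
  through-edge-free y∉T z∉T u v (inj₂ vu∈) u∈T v∈T = through-edge-free y∉T z∉T v u (inj₁ vu∈) v∈T u∈T

  through-within : ∀ {y z} R → Within (y ∷ z ∷ R) (through y z)
  through-within R _ (here refl)                                 = inj₁ a∈T
  through-within R _ (there (here refl))                         = inj₂ (here refl)
  through-within R _ (there (there (here refl)))                 = inj₁ b∈T
  through-within R _ (there (there (there (here refl))))         = inj₂ (there (here refl))
  through-within R _ (there (there (there (there (here refl))))) = inj₁ c∈T

  pair-up : List (Fin n) → List (List (Fin n))
  pair-up []          = []
  pair-up (_ ∷ [])    = []
  pair-up (y ∷ z ∷ R) = through y z ∷ pair-up R

  length-pair-up : ∀ R → length R ≤ suc (length (pair-up R) + length (pair-up R))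
  length-pair-up []          = z≤n
  length-pair-up (_ ∷ [])    = s≤s z≤n
  length-pair-up (y ∷ z ∷ R) = s≤s (s≤s (subst (length R ≤_)
    (sym (+-suc (length (pair-up R)) (length (pair-up R)))) (length-pair-up R)))

  pair-up-within : ∀ R → All (_∉ₗ T) R → All (λ Q → Within R Q × TerminalEdgeFree Q) (pair-up R)
  pair-up-within []          _                     = []
  pair-up-within (_ ∷ [])    _                     = []
  pair-up-within (y ∷ z ∷ R) (y∉T ∷ z∉T ∷ R∩T=∅) =
    (through-within R , through-edge-free y∉T z∉T) ∷
    All.map (map₁ (λ Q-within → within-∷ (within-∷ Q-within))) (pair-up-within R R∩T=∅)

  pair-up-family : ∀ R → Unique R → All (_∉ₗ T) R → IsSPathFamily G S (pair-up R)
  pair-up-family []          _ _ = [] , []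
  pair-up-family (_ ∷ [])    _ _ = [] , []
  pair-up-family (y ∷ z ∷ R) ((y≢z ∷ y∉R) ∷ z∉R ∷ R-unique) (y∉T ∷ z∉T ∷ R∩T=∅)
    with pair-up-family R R-unique R∩T=∅
  ... | spaths , disjoint =
    through-spath y∉T z∉T y≢z ∷ spaths ,
    All.map (λ Q-shape → disjoint-from-within avoids-R (proj₁ Q-shape) (proj₂ Q-shape)) (pair-up-within R R∩T=∅) ∷
    disjoint
    where
    avoids-R : ∀ {x} → x ∈ₗ through y z → x ∉ₗ T → x ∉ₗ R
    avoids-R (there (here refl))                 _ x∈R = All.lookup y∉R x∈R refl
    avoids-R (there (there (there (here refl)))) _ x∈R = All.lookup z∉R x∈R refl
    avoids-R (here refl)                                 x∉T = ⊥-elim (x∉T a∈T)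
    avoids-R (there (there (here refl)))                 x∉T = ⊥-elim (x∉T b∈T)
    avoids-R (there (there (there (there (here refl))))) x∉T = ⊥-elim (x∉T c∈T)

  direct-spath : IsSPath G S T
  direct-spath = ((G-complete a b a≢b , G-complete b c b≢c , tt) , T-unique) , covers-S (λ t∈T → t∈T)

  detour : Fin n → List (Fin n)
  detour x = b ∷ x ∷ c ∷ a ∷ []

  detour-spath : ∀ {x} → x ∉ₗ T → IsSPath G S (detour x)
  detour-spath {x} x∉T =
    ((G-complete b x b≢x , G-complete x c x≢c , G-complete c a (≢-sym a≢c) , tt) ,
     (b≢x ∷ b≢c ∷ ≢-sym a≢b ∷ []) ∷ (x≢c ∷ x≢a ∷ []) ∷ (≢-sym a≢c ∷ []) ∷ [] ∷ []) ,
    covers-S λ { (here refl) → there (there (there (here refl))) ; (there (here refl)) → here refl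
               ; (there (there (here refl))) → there (there (here refl)) }
    where
    b≢x : b ≢ x
    b≢x = ≢-sym (outsider-≢ x∉T b∈T)
    x≢c : x ≢ c
    x≢c = outsider-≢ x∉T c∈T
    x≢a : x ≢ a
    x≢a = outsider-≢ x∉T a∈T

  direct-edge-at-b : ∀ {u v} → EdgeOf u v T → u ≡ b ⊎ v ≡ b
  direct-edge-at-b (inj₁ (inj₁ (refl , refl)))        = inj₂ refl
  direct-edge-at-b (inj₁ (inj₂ (inj₁ (refl , refl)))) = inj₁ refl
  direct-edge-at-b (inj₂ (inj₁ (refl , refl)))        = inj₁ refl
  direct-edge-at-b (inj₂ (inj₂ (inj₁ (refl , refl)))) = inj₂ refl

  detour-terminal-edge : ∀ {x u v} → x ∉ₗ T → Consec u v (detour x) → u ∈ₗ T → v ∈ₗ T → u ≡ c × v ≡ a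
  detour-terminal-edge x∉T (inj₁ (refl , refl))               _   x∈T = ⊥-elim (x∉T x∈T)
  detour-terminal-edge x∉T (inj₂ (inj₁ (refl , refl)))        x∈T _   = ⊥-elim (x∉T x∈T)
  detour-terminal-edge x∉T (inj₂ (inj₂ (inj₁ (refl , refl)))) _   _   = refl , refl

  direct-detour-disjoint : ∀ {x} → x ∉ₗ T → InternallyDisjoint S T (detour x)
  direct-detour-disjoint {x} x∉T = disjoint-if (λ y∈T _ → y∈T) no-common-edge
    where
    no-common-edge : ∀ {u v} → EdgeOf u v T → EdgeOf u v (detour x) → u ∈ₗ T → v ∈ₗ T → ⊥
    no-common-edge uv∈T uv∈detour u∈T v∈T with direct-edge-at-b uv∈T | uv∈detour
    ... | inj₁ refl | inj₁ bv∈ = b≢c (proj₁ (detour-terminal-edge x∉T bv∈ u∈T v∈T))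
    ... | inj₁ refl | inj₂ vb∈ = a≢b (sym (proj₂ (detour-terminal-edge x∉T vb∈ v∈T u∈T)))
    ... | inj₂ refl | inj₁ ub∈ = a≢b (sym (proj₂ (detour-terminal-edge x∉T ub∈ u∈T v∈T)))
    ... | inj₂ refl | inj₂ bu∈ = b≢c (proj₁ (detour-terminal-edge x∉T bu∈ v∈T u∈T))

  family : Fin n → List (Fin n) → List (List (Fin n))
  family x R = T ∷ detour x ∷ pair-up R

  family-ok : ∀ x R → Unique (x ∷ R) → All (_∉ₗ T) (x ∷ R) → IsSPathFamily G S (family x R)
  family-ok x R (x∉R ∷ R-unique) (x∉T ∷ R∩T=∅) with pair-up-family R R-unique R∩T=∅
  ... | spaths , disjoint =
    direct-spath ∷ detour-spath x∉T ∷ spaths ,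
    (direct-detour-disjoint x∉T ∷ All.map (disjoint-from-pair-up direct-avoids) shapes) ∷
    All.map (disjoint-from-pair-up detour-avoids) shapes ∷
    disjoint
    where
    shapes : All (λ Q → Within R Q × TerminalEdgeFree Q) (pair-up R)
    shapes = pair-up-within R R∩T=∅
    disjoint-from-pair-up : ∀ {P Q} → (∀ {y} → y ∈ₗ P → y ∉ₗ T → y ∉ₗ R) →
                            Within R Q × TerminalEdgeFree Q → InternallyDisjoint S P Q
    disjoint-from-pair-up avoids Q-shape = disjoint-from-within avoids (proj₁ Q-shape) (proj₂ Q-shape)
    direct-avoids : ∀ {y} → y ∈ₗ T → y ∉ₗ T → y ∉ₗ R
    direct-avoids y∈T y∉T = ⊥-elim (y∉T y∈T)
    detour-avoids : ∀ {y} → y ∈ₗ detour x → y ∉ₗ T → y ∉ₗ R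
    detour-avoids (there (here refl))               _   y∈R = All.lookup x∉R y∈R refl
    detour-avoids (here refl)                       y∉T     = ⊥-elim (y∉T b∈T)
    detour-avoids (there (there (here refl)))       y∉T     = ⊥-elim (y∉T c∈T)
    detour-avoids (there (there (there (here refl)))) y∉T   = ⊥-elim (y∉T a∈T)

  -- Counting: the n - 3 non-terminals give 2 + ⌊(n - 4)/2⌋ = n/2 paths.
  large-family : ∀ k → k + k ≡ n → 4 ≤ n → Σ (List (List (Fin n))) λ F → IsSPathFamily G S F × k ≤ length F
  large-family k k+k≡n 4≤n = by-outsiders (outsiders (allFin n)) n≤3+O O-unique O∩T=∅
    where
    n≤3+O : n ≤ 3 + length (outsiders (allFin n))
    n≤3+O = subst (_≤ 3 + length (outsiders (allFin n))) (length-tabulate (λ x → x))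
                  (length-≤-3+outsiders (allFin n) (Unique.allFin⁺ n))
    O-unique : Unique (outsiders (allFin n))
    O-unique = outsiders-unique (Unique.allFin⁺ n)
    O∩T=∅ : All (_∉ₗ T) (outsiders (allFin n))
    O∩T=∅ = All.tabulate λ {x} x∈O → proj₂ (∈-outsiders⁻ (allFin n) x∈O)
    by-outsiders : ∀ O → n ≤ 3 + length O → Unique O → All (_∉ₗ T) O →
                   Σ (List (List (Fin n))) λ F → IsSPathFamily G S F × k ≤ length F
    by-outsiders []      n≤3 _        _    = ⊥-elim (1+n≰n (≤-trans 4≤n n≤3))
    by-outsiders (x ∷ R) n≤4+R O-unique O∩T=∅ =
      family x R , family-ok x R O-unique O∩T=∅ ,
      halve k (length (family x R)) (subst₂ _≤_ (sym k+k≡n) (count (length (pair-up R)))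
        (≤-trans n≤4+R (+-monoʳ-≤ 4 (length-pair-up R))))
      where
      count : ∀ p → 4 + suc (p + p) ≡ suc ((2 + p) + (2 + p))
      count = solve 1 (λ p → con 4 :+ (con 1 :+ (p :+ p)) := con 1 :+ ((con 2 :+ p) :+ (con 2 :+ p))) refl

third-vertex : ∀ {n} → 3 ≤ n → (u v : Fin n) → Σ (Fin n) λ w → u ≢ w × v ≢ w
third-vertex (s≤s (s≤s (s≤s _))) Fin.zero             Fin.zero             = Fin.suc Fin.zero , (λ ()) , (λ ())
third-vertex (s≤s (s≤s (s≤s _))) Fin.zero             (Fin.suc Fin.zero)    = Fin.suc (Fin.suc Fin.zero) , (λ ()) , (λ ())
third-vertex (s≤s (s≤s (s≤s _))) Fin.zero             (Fin.suc (Fin.suc _)) = Fin.suc Fin.zero , (λ ()) , (λ ())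
third-vertex (s≤s (s≤s (s≤s _))) (Fin.suc Fin.zero)    Fin.zero             = Fin.suc (Fin.suc Fin.zero) , (λ ()) , (λ ())
third-vertex (s≤s (s≤s (s≤s _))) (Fin.suc Fin.zero)    (Fin.suc _)          = Fin.zero , (λ ()) , (λ ())
third-vertex (s≤s (s≤s (s≤s _))) (Fin.suc (Fin.suc _)) Fin.zero             = Fin.suc Fin.zero , (λ ()) , (λ ())
third-vertex (s≤s (s≤s (s≤s _))) (Fin.suc (Fin.suc _)) (Fin.suc _)          = Fin.zero , (λ ()) , (λ ())

¬¬-πG-exists : ∀ {n} (G : Graph n) (S : Subset n) → (∀ F → IsSPathFamily G S F → length F ≤ n) →
               ¬ ¬ (Σ ℕ λ m → PiG≡ G S m)
¬¬-πG-exists {n} G S bounded no-πG =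
  ¬¬-maximum FamilyOfSize ([] , ([] , []) , refl) n (λ { _ (F , isF , refl) → bounded F isF })
    λ (m , has-m , m-max) → no-πG (m , has-m , λ F isF → m-max (length F) (F , isF , refl))
  where
  FamilyOfSize : ℕ → Set
  FamilyOfSize m = Σ (List (List (Fin n))) λ F → IsSPathFamily G S F × length F ≡ m

complete⇒πG : ∀ {n k} (G : Graph n) → IsComplete G → 4 ≤ n → k + k ≡ n →
              ∀ S → ∣ S ∣ ≡ 3 → PiG≡ G S k
complete⇒πG {n} {k} G G-complete 4≤n k+k≡n S |S|≡3 with size-3⇒triple S |S|≡3
... | a , b , c , S=abc with Enumerates.unique S=abc
... | (a≢b ∷ a≢c ∷ []) ∷ (b≢c ∷ []) ∷ [] ∷ []
    with Construction.large-family G G-complete a b c a≢b b≢c a≢c S S=abc k k+k≡n 4≤n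
... | F , isF , k≤|F| = (F , isF , ≤-antisym (at-most-k F isF) k≤|F|) , at-most-k
  where
  at-most-k : ∀ F′ → IsSPathFamily G S F′ → length F′ ≤ k
  at-most-k F′ isF′ = halve (length F′) k (≤-trans
    (UpperBound.family-bound G a b c a≢b b≢c a≢c S S=abc F′ isF′) (subst (λ m → m ≤ suc (k + k)) k+k≡n (n≤1+n (k + k))))

complete⇒π₃ : ∀ {n k} (G : Graph n) → IsComplete G → 4 ≤ n → k + k ≡ n → Pik≡ G 3 k
complete⇒π₃ G G-complete 4≤n@(s≤s (s≤s (s≤s (s≤s _)))) k+k≡n =
  (S₀ , |S₀|≡3 , complete⇒πG G G-complete 4≤n k+k≡n S₀ |S₀|≡3) ,
  λ S p |S|≡3 (_ , p-max) → let (F , isF , |F|≡k) , _ = complete⇒πG G G-complete 4≤n k+k≡n S |S|≡3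
                            in subst (_≤ p) |F|≡k (p-max F isF)
  where
  abc₀ : List (Fin _)
  abc₀ = Fin.zero ∷ Fin.suc Fin.zero ∷ Fin.suc (Fin.suc Fin.zero) ∷ []
  S₀ : Subset _
  S₀ = fromList abc₀
  |S₀|≡3 : ∣ S₀ ∣ ≡ 3
  |S₀|≡3 = enumerates⇒size (fromList-enumerates abc₀ (((λ ()) ∷ (λ ()) ∷ []) ∷ ((λ ()) ∷ []) ∷ [] ∷ []))

nonadjacent⇒¬π₃ : ∀ {n k} (G : Graph n) → 4 ≤ n → k + k ≡ n → ∀ {u v} → u ≢ v → adj G u v ≡ false →
                  ¬ Pik≡ G 3 k
nonadjacent⇒¬π₃ {n} {k} G 4≤n k+k≡n {u} {v} u≢v u≁v (_ , k-min)
  with third-vertex (≤-trans (n≤1+n 3) 4≤n) u v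
... | w , u≢w , v≢w =
  ¬¬-πG-exists G S (λ F isF → ≤-trans (m≤m+n _ _) (family-bound F isF)) too-small
  where
  uvw-unique : Unique (u ∷ v ∷ w ∷ [])
  uvw-unique = (u≢v ∷ u≢w ∷ []) ∷ (v≢w ∷ []) ∷ [] ∷ []
  S : Subset n
  S = fromList (u ∷ v ∷ w ∷ [])
  S=uvw : Enumerates (u ∷ v ∷ w ∷ []) S
  S=uvw = fromList-enumerates (u ∷ v ∷ w ∷ []) uvw-unique
  |S|≡3 : ∣ S ∣ ≡ 3
  |S|≡3 = enumerates⇒size S=uvw
  open UpperBound G u v w u≢v v≢w u≢w S S=uvw using (family-bound; family-bound-nonadjacent)
  -- A maximum family F would have k ≤ |F| by minimality of k, but 2|F| < n = 2k.
  too-small : ¬ (Σ ℕ λ m → PiG≡ G S m)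
  too-small (m , πG=m) with πG=m
  ... | (F , isF , refl) , _ =
    1+n≰n (≤-trans (family-bound-nonadjacent u≁v F isF)
                   (subst (_≤ m + m) k+k≡n (+-mono-≤ k≤m k≤m)))
    where
    k≤m : k ≤ m
    k≤m = k-min S m |S|≡3 πG=m

lemma1p4 : (n : ℕ) → 4 ≤ n → 2 ∣ n → (G : Graph n) →
           Pik≡ G 3 (n / 2) ⇔ IsComplete G
lemma1p4 n 4≤n (divides k n≡k*2) G =
  mk⇔ (λ π₃=n/2 u v u≢v → adjacent (subst (Pik≡ G 3) n/2≡k π₃=n/2) u≢v)
      (λ G-complete → subst (Pik≡ G 3) (sym n/2≡k) (complete⇒π₃ G G-complete 4≤n k+k≡n))
  where
  k+k≡n : k + k ≡ n
  k+k≡n = sym (trans n≡k*2 (trans (*-comm k 2) (cong (k +_) (+-identityʳ k))))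
  n/2≡k : n / 2 ≡ k
  n/2≡k = trans (cong (_/ 2) n≡k*2) (m*n/n≡m k 2)
  adjacent : Pik≡ G 3 k → ∀ {u v} → u ≢ v → adj G u v ≡ true
  adjacent π₃=k {u} {v} u≢v with adj G u v in u~v
  ... | true  = refl
  ... | false = ⊥-elim (nonadjacent⇒¬π₃ G 4≤n k+k≡n u≢v u~v π₃=k)
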